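{- If $h(z,\vec y/\vec a)$ is a function in ${\sf PCSF}$ and $R(z,\vec y/\vec a)$ is a relation in ${\sf PCSF}$, then the functions \[f(x,\vec y/\vec a)=\bigcup\{h(z,\vec y/\vec a): z\in x,\ R(z,\vec y/\vec a)\}\quad\text{and}\quad g(x,\vec y/\vec a)=\{h(z,\vec y/\vec a): z\in x,\ R(z,\vec y/\vec a)\}\] are in ${\sf PCSF}$.
   Context: Functions are set-theoretic functions on the universe of sets, written $f(x_1,\ldots,x_n/a_1,\ldots,a_m)$: arguments before the slash are called normal, after it safe (either list may be empty, written $-$). A relation $R(\vec x/\vec a)$ is in ${\sf PCSF}$ iff its characteristic function ($1=\{\emptyset\}$ where $R$ holds, $0=\emptyset$ otherwise) is in ${\sf PCSF}$. The class ${\sf PCSF}^-$ consists of functions with no normal arguments; it contains the projections $\pi^{ -,m}_j(-/a_1,\ldots,a_m)=a_j$, $\mathrm{pair}(-/a,b)=\{a,b\}$, $\mathrm{null}(-/-)=\emptyset$, $\mathrm{union}(-/a)=\bigcup a$, and $\mathrm{Cond}_\in(-/a,b,c,d)$, which equals $a$ if $c\in d$ and $b$ otherwise; and it is closed under composition $f(-/\vec a)=h(-/t_1(-/\vec a),\ldots,t_k(-/\vec a))$ and under safe separation: if $h(-/\vec a,b)\in{\sf PCSF}^-$ then $f(-/\vec a,c)=\{b\in c: h(-/\vec a,b)\neq\emptyset\}\in{\sf PCSF}^-$. The class ${\sf PCSF}$ is the smallest class containing ${\sf PCSF}^-$ and all projections $\pi^{n,m}_j(x_1,\ldots,x_n/x_{n+1},\ldots,x_{n+m})=x_j$,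 and closed under safe composition $f(\vec x/\vec a)=h(r_1(\vec x/-),\ldots,r_k(\vec x/-)/t_1(\vec x/\vec a),\ldots,t_l(\vec x/\vec a))$ (with $h,r_i,t_j\in{\sf PCSF}$, the $r_i$ having no safe arguments) and predicative set recursion $f(x,\vec y/\vec a)=h(x,\vec y/\vec a,\{f(z,\vec y/\vec a): z\in x\})$ (with $h\in{\sf PCSF}$). -}

module Defs where

open import Data.Nat using (ℕ; zero; suc)
open import Data.Fin using (Fin; zero; suc)
open import Data.Vec using (Vec; []; _∷_; _∷ʳ_; lookup; tabulate; head; tail; init; last)
open import Data.Product using (Σ; _×_; _,_; ∃)
open import Data.Sum using (_⊎_)
open import Relation.Nullary using (¬_; Dec; yes; no)
open import Relation.Binary.PropositionalEquality using (_≡_)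
open import Induction.WellFounded using (WellFounded)

-- Equality of sets is propositional equality (extensionality axiom below).
record SetModel : Set₁ where
  field
    V        : Set
    _∈_      : V → V → Set
    ∈-dec    : ∀ a b → Dec (a ∈ b)
    extens   : ∀ {a b} → (∀ z → (z ∈ a → z ∈ b) × (z ∈ b → z ∈ a)) → a ≡ b
    found    : WellFounded _∈_
    ∅        : V
    ∅-spec   : ∀ z → ¬ (z ∈ ∅)
    pair     : V → V → V
    pair-spec : ∀ a b z → (z ∈ pair a b → (z ≡ a ⊎ z ≡ b)) × ((z ≡ a ⊎ z ≡ b) → z ∈ pair a b)
    ⋃        : V → V
    ⋃-spec   : ∀ a z → (z ∈ ⋃ a → ∃ λ w → w ∈ a × z ∈ w) × ((∃ λ w → w ∈ a × z ∈ w) → z ∈ ⋃ a)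
    sep      : (V → Set) → V → V
    sep-spec : ∀ P c z → (z ∈ sep P c → z ∈ c × P z) × (z ∈ c × P z → z ∈ sep P c)
    repl     : (V → V) → V → V
    repl-spec : ∀ F x z → (z ∈ repl F x → ∃ λ w → w ∈ x × z ≡ F w) × ((∃ λ w → w ∈ x × z ≡ F w) → z ∈ repl F x)

module PCSFDefs (M : SetModel) where
  open SetModel M public

  one : V
  one = pair ∅ ∅

  Cond : V → V → V → V → V
  Cond a b c d with ∈-dec c d
  ... | yes _ = a
  ... | no  _ = b

  -- PCSF⁻ m f : f(-/a₁..aₘ) (no normal arguments) is in PCSF⁻.
  data PCSF⁻ : (m : ℕ) → (Vec V m → V) → Set where
    proj⁻  : ∀ {m} (j : Fin m) → PCSF⁻ m (λ a → lookup a j)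
    pair⁻  : PCSF⁻ 2 (λ a → pair (head a) (head (tail a)))
    null⁻  : PCSF⁻ 0 (λ _ → ∅)
    union⁻ : PCSF⁻ 1 (λ a → ⋃ (head a))
    cond⁻  : PCSF⁻ 4 (λ a → Cond (lookup a zero) (lookup a (suc zero))
                                 (lookup a (suc (suc zero))) (lookup a (suc (suc (suc zero)))))
    comp⁻  : ∀ {m k} {h : Vec V k → V} {t : Fin k → Vec V m → V} →
             PCSF⁻ k h → (∀ i → PCSF⁻ m (t i)) →
             PCSF⁻ m (λ a → h (tabulate (λ i → t i a)))
    sep⁻   : ∀ {m} {h : Vec V (suc m) → V} → PCSF⁻ (suc m) h →
             PCSF⁻ (suc m) (λ ac → sep (λ b → ¬ (h (init ac ∷ʳ b) ≡ ∅)) (last ac))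
    -- classes of set-theoretic functions are extensional
    ext⁻   : ∀ {m} {f g : Vec V m → V} → PCSF⁻ m f → (∀ a → f a ≡ g a) → PCSF⁻ m g

  -- PCSF n m f : f(x₁..xₙ / a₁..aₘ) is in PCSF.
  data PCSF : (n m : ℕ) → (Vec V n → Vec V m → V) → Set where
    base   : ∀ {m} {f : Vec V m → V} → PCSF⁻ m f → PCSF 0 m (λ _ a → f a)
    projN  : ∀ {n m} (j : Fin n) → PCSF n m (λ x a → lookup x j)
    projS  : ∀ {n m} (j : Fin m) → PCSF n m (λ x a → lookup a j)
    scomp  : ∀ {n m k l} {h : Vec V k → Vec V l → V}
               {r : Fin k → Vec V n → Vec V 0 → V} {t : Fin l → Vec V n → Vec V m → V} →
             PCSF k l h → (∀ i → PCSF n 0 (r i)) → (∀ j → PCSF n m (t j)) →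
             PCSF n m (λ x a → h (tabulate (λ i → r i x [])) (tabulate (λ j → t j x a)))
    -- predicative set recursion: f(x,y/a) = h(x,y/a,{f(z,y/a) : z ∈ x});
    -- by foundation the recursion equation determines f uniquely.
    rec    : ∀ {n m} {h : Vec V (suc n) → Vec V (suc m) → V} {f : Vec V (suc n) → Vec V m → V} →
             PCSF (suc n) (suc m) h →
             (∀ x y a → f (x ∷ y) a ≡ h (x ∷ y) (a ∷ʳ repl (λ z → f (z ∷ y) a) x)) →
             PCSF (suc n) m f
    ext    : ∀ {n m} {f g : Vec V n → Vec V m → V} → PCSF n m f → (∀ x a → f x a ≡ g x a) → PCSF n m g

  PCSFRel : (n m : ℕ) → (Vec V n → Vec V m → Set) → Set
  PCSFRel n m R = Σ (Vec V n → Vec V m → V) λ χ →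
    PCSF n m χ × (∀ x a → (R x a → χ x a ≡ one) × (¬ R x a → χ x a ≡ ∅))

module Submission where

open import Defs
open import Data.Nat using (suc; zero)
open import Data.Fin using (Fin; zero; suc; inject₁; fromℕ)
open import Data.Vec using (Vec; _∷_; []; head; tail; init; last; tabulate; lookup; _∷ʳ_)
open import Data.Vec.Properties using (tabulate∘lookup; init-∷ʳ; last-∷ʳ)
open import Data.Product using (_×_; _,_; proj₁; proj₂; ∃)
open import Data.Sum using (inj₁; inj₂)
open import Data.Empty using (⊥-elim)
open import Relation.Nullary using (¬_; Dec; yes; no)
open import Relation.Binary.PropositionalEquality
  using (_≡_; refl; sym; trans; cong; cong₂; subst; module ≡-Reasoning)

-- Write U_F(x,y/a) = ⋃{F(z,y/a) : z ∈ x}.  The heart of the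
-- proof is that PCSF is closed under this "union-replacement" (module
-- UnionReplacement).  Predicative recursion only hands the step function the
-- set {t(z) : z ∈ x} of earlier VALUES, so we recurse on a trace
--     T(x) = { {∅, F(x)} , {{U_F(x)}} }
-- whose first component is tagged (contains ∅) and whose second is not.
-- From {T(z) : z ∈ x} the step function separates the tagged components
-- {∅, F(z)} and takes a double union to get U_F(x); U_F is read off T(x) by
-- separating the untagged component and taking three unions.
-- The theorem then follows with F(z) = Cond_∈({h(z)}, ∅, ∅, χ_R(z)), which
-- is {h(z)} when R(z) holds and ∅ otherwise: U_F(x) is then exactly
-- g(x) = {h(z) : z ∈ x, R(z)}, and f = ⋃ g.

tabulate-inject₁≡init : ∀ {A : Set} {m} (as : Vec A (suc m)) →
                        tabulate (λ j → lookup as (inject₁ j)) ≡ init as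
tabulate-inject₁≡init {m = zero}  (x ∷ [])  = refl
tabulate-inject₁≡init {m = suc m} (x ∷ as) = cong (x ∷_) (tabulate-inject₁≡init as)

lookup-fromℕ≡last : ∀ {A : Set} {m} (as : Vec A (suc m)) → lookup as (fromℕ m) ≡ last as
lookup-fromℕ≡last {m = zero}  (x ∷ [])  = refl
lookup-fromℕ≡last {m = suc m} (x ∷ as) = lookup-fromℕ≡last as

module SetFacts (M : SetModel) where
  open PCSFDefs M

  sing : V → V
  sing a = pair a a

  ∈pair₁ : ∀ a b → a ∈ pair a b
  ∈pair₁ a b = proj₂ (pair-spec a b a) (inj₁ refl)

  ∈pair₂ : ∀ a b → b ∈ pair a b
  ∈pair₂ a b = proj₂ (pair-spec a b b) (inj₂ refl)

  ∈sing⇒≡ : ∀ {a z} → z ∈ sing a → z ≡ a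
  ∈sing⇒≡ {a} {z} z∈ with proj₁ (pair-spec a a z) z∈
  ... | inj₁ z≡a = z≡a
  ... | inj₂ z≡a = z≡a

  sing≢∅ : ∀ a → ¬ (sing a ≡ ∅)
  sing≢∅ a eq = ∅-spec a (subst (a ∈_) eq (∈pair₁ a a))

  ⋃-sing : ∀ a → ⋃ (sing a) ≡ a
  ⋃-sing a = extens λ z →
    (λ z∈ → let (w , w∈ , z∈w) = proj₁ (⋃-spec (sing a) z) z∈ in subst (z ∈_) (∈sing⇒≡ w∈) z∈w) ,
    (λ z∈a → proj₂ (⋃-spec (sing a) z) (a , ∈pair₁ a a , z∈a))

  sep-ext : ∀ {P Q : V → Set} c → (∀ z → (P z → Q z) × (Q z → P z)) → sep P c ≡ sep Q c
  sep-ext {P} {Q} c P⇔Q = extens λ z →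
    (λ z∈ → let (z∈c , pz) = proj₁ (sep-spec P c z) z∈ in proj₂ (sep-spec Q c z) (z∈c , proj₁ (P⇔Q z) pz)) ,
    (λ z∈ → let (z∈c , qz) = proj₁ (sep-spec Q c z) z∈ in proj₂ (sep-spec P c z) (z∈c , proj₂ (P⇔Q z) qz))

  -- Every predicate is decidable on the elements of a set, since
  -- P z ⇔ z ∈ {u ∈ x : P u} and membership is decidable.
  decide-on : ∀ (P : V → Set) {x z} → z ∈ x → Dec (P z)
  decide-on P {x} {z} z∈x with ∈-dec z (sep P x)
  ... | yes z∈ = yes (proj₂ (proj₁ (sep-spec P x z) z∈))
  ... | no  z∉ = no λ pz → z∉ (proj₂ (sep-spec P x z) (z∈x , pz))

  Cond-yes : ∀ a b c d → c ∈ d → Cond a b c d ≡ a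
  Cond-yes a b c d c∈d with ∈-dec c d
  ... | yes _   = refl
  ... | no  c∉d = ⊥-elim (c∉d c∈d)

  Cond-no : ∀ a b c d → ¬ (c ∈ d) → Cond a b c d ≡ b
  Cond-no a b c d c∉d with ∈-dec c d
  ... | yes c∈d = ⊥-elim (c∉d c∈d)
  ... | no  _   = refl

  Cond-characteristic : ∀ {P : Set} a b c → (P → c ≡ one) × (¬ P → c ≡ ∅) →
                        (P → Cond a b ∅ c ≡ a) × (¬ P → Cond a b ∅ c ≡ b)
  Cond-characteristic a b c (c≡one , c≡∅) =
    (λ p  → Cond-yes a b ∅ c (subst (∅ ∈_) (sym (c≡one p)) (∈pair₁ ∅ ∅))) ,
    (λ ¬p → Cond-no a b ∅ c (λ ∅∈c → ∅-spec ∅ (subst (∅ ∈_) (c≡∅ ¬p) ∅∈c)))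

  ∈-⋃-repl : ∀ F x w → (w ∈ ⋃ (repl F x) → ∃ λ z → z ∈ x × w ∈ F z)
                      × ((∃ λ z → z ∈ x × w ∈ F z) → w ∈ ⋃ (repl F x))
  ∈-⋃-repl F x w = to , from
    where
    to : w ∈ ⋃ (repl F x) → ∃ λ z → z ∈ x × w ∈ F z
    to w∈ with proj₁ (⋃-spec (repl F x) w) w∈
    ... | v , v∈ , w∈v with proj₁ (repl-spec F x v) v∈
    ... | z , z∈x , refl = z , z∈x , w∈v
    from : (∃ λ z → z ∈ x × w ∈ F z) → w ∈ ⋃ (repl F x)
    from (z , z∈x , w∈Fz) = proj₂ (⋃-spec (repl F x) w) (F z , proj₂ (repl-spec F x (F z)) (z , z∈x , refl) , w∈Fz)

  ⋃-repl-select : ∀ {P : V → Set} F g x →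
                  (∀ z → (P z → F z ≡ sing (g z)) × (¬ P z → F z ≡ ∅)) →
                  ⋃ (repl F x) ≡ repl g (sep P x)
  ⋃-repl-select {P} F g x F-sel = extens λ w → to w , from w
    where
    to : ∀ w → w ∈ ⋃ (repl F x) → w ∈ repl g (sep P x)
    to w w∈ with proj₁ (∈-⋃-repl F x w) w∈
    ... | z , z∈x , w∈Fz with decide-on P z∈x
    ...   | yes pz = proj₂ (repl-spec g (sep P x) w)
                       (z , proj₂ (sep-spec P x z) (z∈x , pz) , ∈sing⇒≡ (subst (w ∈_) (proj₁ (F-sel z) pz) w∈Fz))
    ...   | no ¬pz = ⊥-elim (∅-spec w (subst (w ∈_) (proj₂ (F-sel z) ¬pz) w∈Fz))
    from : ∀ w → w ∈ repl g (sep P x) → w ∈ ⋃ (repl F x)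
    from w w∈ with proj₁ (repl-spec g (sep P x) w) w∈
    ... | z , z∈ , refl =
      let (z∈x , pz) = proj₁ (sep-spec P x z) z∈ in
      proj₂ (∈-⋃-repl F x (g z)) (z , z∈x , subst (g z ∈_) (sym (proj₁ (F-sel z) pz)) (∈pair₁ (g z) (g z)))

  ⋃⋃-repl-pair∅ : ∀ F x → ⋃ (⋃ (repl (λ z → pair ∅ (F z)) x)) ≡ ⋃ (repl F x)
  ⋃⋃-repl-pair∅ F x = extens λ w → to w , from w
    where
    to : ∀ w → w ∈ ⋃ (⋃ (repl (λ z → pair ∅ (F z)) x)) → w ∈ ⋃ (repl F x)
    to w w∈ with proj₁ (⋃-spec _ w) w∈
    ... | v , v∈ , w∈v with proj₁ (∈-⋃-repl (λ z → pair ∅ (F z)) x v) v∈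
    ... | z , z∈x , v∈pair with proj₁ (pair-spec ∅ (F z) v) v∈pair
    ...   | inj₁ refl = ⊥-elim (∅-spec w w∈v)
    ...   | inj₂ refl = proj₂ (∈-⋃-repl F x w) (z , z∈x , w∈v)
    from : ∀ w → w ∈ ⋃ (repl F x) → w ∈ ⋃ (⋃ (repl (λ z → pair ∅ (F z)) x))
    from w w∈ with proj₁ (∈-⋃-repl F x w) w∈
    ... | z , z∈x , w∈Fz = proj₂ (⋃-spec _ w)
      (F z , proj₂ (∈-⋃-repl (λ z → pair ∅ (F z)) x (F z)) (z , z∈x , ∈pair₂ ∅ (F z)) , w∈Fz)

  sep-tagged : ∀ (A B : V → V) x → (∀ z → ∅ ∈ A z × ¬ (∅ ∈ B z)) →
               sep (λ e → ∅ ∈ e) (⋃ (repl (λ z → pair (A z) (B z)) x)) ≡ repl A x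
  sep-tagged A B x tags = extens λ e → to e , from e
    where
    AB : V → V
    AB z = pair (A z) (B z)
    to : ∀ e → e ∈ sep (λ e → ∅ ∈ e) (⋃ (repl AB x)) → e ∈ repl A x
    to e e∈ with proj₁ (sep-spec _ _ e) e∈
    ... | e∈⋃ , ∅∈e with proj₁ (∈-⋃-repl AB x e) e∈⋃
    ... | z , z∈x , e∈AB with proj₁ (pair-spec (A z) (B z) e) e∈AB
    ...   | inj₁ e≡A = proj₂ (repl-spec A x e) (z , z∈x , e≡A)
    ...   | inj₂ e≡B = ⊥-elim (proj₂ (tags z) (subst (∅ ∈_) e≡B ∅∈e))
    from : ∀ e → e ∈ repl A x → e ∈ sep (λ e → ∅ ∈ e) (⋃ (repl AB x))
    from e e∈ with proj₁ (repl-spec A x e) e∈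
    ... | z , z∈x , refl = proj₂ (sep-spec _ _ (A z))
      (proj₂ (∈-⋃-repl AB x (A z)) (z , z∈x , ∈pair₁ (A z) (B z)) , proj₁ (tags z))

  sep-untagged : ∀ a b → ∅ ∈ a → ¬ (∅ ∈ b) → sep (λ e → ¬ (∅ ∈ e)) (pair a b) ≡ sing b
  sep-untagged a b ∅∈a ∅∉b = extens λ z → to z , from z
    where
    to : ∀ z → z ∈ sep (λ e → ¬ (∅ ∈ e)) (pair a b) → z ∈ sing b
    to z z∈ with proj₁ (sep-spec _ (pair a b) z) z∈
    ... | z∈ab , ∅∉z with proj₁ (pair-spec a b z) z∈ab
    ...   | inj₁ refl = ⊥-elim (∅∉z ∅∈a)
    ...   | inj₂ refl = ∈pair₁ b b
    from : ∀ z → z ∈ sing b → z ∈ sep (λ e → ¬ (∅ ∈ e)) (pair a b)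
    from z z∈ with ∈sing⇒≡ z∈
    ... | refl = proj₂ (sep-spec _ (pair a b) b) (∈pair₂ a b , ∅∉b)

module Closure (M : SetModel) where
  open PCSFDefs M
  open SetFacts M

  null⁻ᵐ : ∀ {m} → PCSF⁻ m (λ _ → ∅)
  null⁻ᵐ = comp⁻ {t = λ ()} null⁻ (λ ())

  one⁻ : ∀ {m} → PCSF⁻ m (λ _ → one)
  one⁻ = comp⁻ {t = lookup ((λ _ → ∅) ∷ (λ _ → ∅) ∷ [])} pair⁻ λ { zero → null⁻ᵐ ; (suc zero) → null⁻ᵐ }

  Cond∅⁻ : ∀ {p q} → PCSF⁻ 1 (λ _ → p) → PCSF⁻ 1 (λ _ → q) → PCSF⁻ 1 (λ v → Cond p q ∅ (head v))
  Cond∅⁻ {p} {q} p⁻ q⁻ = ext⁻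
    (comp⁻ {t = lookup ((λ _ → p) ∷ (λ _ → q) ∷ (λ _ → ∅) ∷ (λ v → lookup v zero) ∷ [])} cond⁻
      λ { zero → p⁻ ; (suc zero) → q⁻ ; (suc (suc zero)) → null⁻ᵐ ; (suc (suc (suc zero))) → proj⁻ zero })
    λ { (b ∷ []) → refl }

  -- Separating the members that contain ∅: safe separation with the test
  -- Cond_∈(1, ∅, ∅, e), which is nonempty exactly when ∅ ∈ e.
  sepHas∅⁻ : PCSF⁻ 1 (λ v → sep (λ e → ∅ ∈ e) (head v))
  sepHas∅⁻ = ext⁻ (sep⁻ (Cond∅⁻ one⁻ null⁻ᵐ))
    λ { (c ∷ []) → sep-ext c λ e → test⇒∅∈ e , λ ∅∈e eq → sing≢∅ ∅ (trans (sym (Cond-yes one ∅ ∅ e ∅∈e)) eq) }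
    where
    test⇒∅∈ : ∀ e → ¬ (Cond one ∅ ∅ e ≡ ∅) → ∅ ∈ e
    test⇒∅∈ e ne with ∈-dec ∅ e
    ... | yes ∅∈e = ∅∈e
    ... | no  _   = ⊥-elim (ne refl)

  sepLacks∅⁻ : PCSF⁻ 1 (λ v → sep (λ e → ¬ (∅ ∈ e)) (head v))
  sepLacks∅⁻ = ext⁻ (sep⁻ (Cond∅⁻ null⁻ᵐ one⁻))
    λ { (c ∷ []) → sep-ext c λ e →
          (λ ne ∅∈e → ne (Cond-yes ∅ one ∅ e ∅∈e)) ,
          (λ ∅∉e eq → sing≢∅ ∅ (trans (sym (Cond-no ∅ one ∅ e ∅∉e)) eq)) }

  lift⁻ : ∀ {n m k} {op : Vec V k → V} {t : Fin k → Vec V n → Vec V m → V} →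
          PCSF⁻ k op → (∀ i → PCSF n m (t i)) → PCSF n m (λ x a → op (tabulate (λ i → t i x a)))
  lift⁻ {t = t} op pt = scomp {r = λ ()} {t = t} (base op) (λ ()) pt

  PCSF-null : ∀ {n m} → PCSF n m (λ _ _ → ∅)
  PCSF-null = lift⁻ {t = λ ()} null⁻ (λ ())

  PCSF-⋃ : ∀ {n m} {f : Vec V n → Vec V m → V} → PCSF n m f → PCSF n m (λ x a → ⋃ (f x a))
  PCSF-⋃ {f = f} pf = lift⁻ {t = λ _ → f} union⁻ (λ _ → pf)

  PCSF-pair : ∀ {n m} {f g : Vec V n → Vec V m → V} → PCSF n m f → PCSF n m g →
              PCSF n m (λ x a → pair (f x a) (g x a))
  PCSF-pair {f = f} {g} pf pg = lift⁻ {t = lookup (f ∷ g ∷ [])} pair⁻ λ { zero → pf ; (suc zero) → pg }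

  PCSF-sing : ∀ {n m} {f : Vec V n → Vec V m → V} → PCSF n m f → PCSF n m (λ x a → sing (f x a))
  PCSF-sing pf = PCSF-pair pf pf

  PCSF-Cond : ∀ {n m} {f g c d : Vec V n → Vec V m → V} →
              PCSF n m f → PCSF n m g → PCSF n m c → PCSF n m d →
              PCSF n m (λ x a → Cond (f x a) (g x a) (c x a) (d x a))
  PCSF-Cond {f = f} {g} {c} {d} pf pg pc pd = lift⁻ {t = lookup (f ∷ g ∷ c ∷ d ∷ [])} cond⁻
    λ { zero → pf ; (suc zero) → pg ; (suc (suc zero)) → pc ; (suc (suc (suc zero))) → pd }

  PCSF-sepHas∅ : ∀ {n m} {f : Vec V n → Vec V m → V} → PCSF n m f →
                 PCSF n m (λ x a → sep (λ e → ∅ ∈ e) (f x a))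
  PCSF-sepHas∅ {f = f} pf = lift⁻ {t = λ _ → f} sepHas∅⁻ (λ _ → pf)

  PCSF-sepLacks∅ : ∀ {n m} {f : Vec V n → Vec V m → V} → PCSF n m f →
                   PCSF n m (λ x a → sep (λ e → ¬ (∅ ∈ e)) (f x a))
  PCSF-sepLacks∅ {f = f} pf = lift⁻ {t = λ _ → f} sepLacks∅⁻ (λ _ → pf)

  PCSF-weaken : ∀ {n m} {f : Vec V n → Vec V m → V} → PCSF n m f →
                PCSF n (suc m) (λ x as → f x (init as))
  PCSF-weaken {f = f} pf =
    ext (scomp {r = λ i x _ → lookup x i} {t = λ j x as → lookup as (inject₁ j)}
               pf projN (λ j → projS (inject₁ j)))
        (λ x as → cong₂ f (tabulate∘lookup x) (tabulate-inject₁≡init as))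

  PCSF-lastSafe : ∀ {n m} → PCSF n (suc m) (λ x as → last as)
  PCSF-lastSafe {m = m} = ext (projS (fromℕ m)) (λ x as → lookup-fromℕ≡last as)

module UnionReplacement (M : SetModel) where
  open PCSFDefs M
  open SetFacts M
  open Closure M

  -- Two encodings that separation by "∅ ∈ e" tells apart.
  tagged : V → V
  tagged c = pair ∅ c

  untagged : V → V
  untagged c = sing (sing c)

  ∅∈tagged : ∀ c → ∅ ∈ tagged c
  ∅∈tagged c = ∈pair₁ ∅ c

  ∅∉untagged : ∀ c → ¬ (∅ ∈ untagged c)
  ∅∉untagged c ∅∈ = sing≢∅ c (sym (∈sing⇒≡ ∅∈))

  -- From a set of traces {T(z) : z ∈ x}, recover ⋃{F(z) : z ∈ x}.
  collect : V → V
  collect s = ⋃ (⋃ (sep (λ e → ∅ ∈ e) (⋃ s)))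

  -- From a single trace T(x), recover its stored result.
  result : V → V
  result q = ⋃ (⋃ (⋃ (sep (λ e → ¬ (∅ ∈ e)) q)))

  module _ {n m} (F : Vec V (suc n) → Vec V m → V) where

    U : Vec V (suc n) → Vec V m → V
    U xy a = ⋃ (repl (λ z → F (z ∷ tail xy) a) (head xy))

    trace : Vec V (suc n) → Vec V m → V
    trace xy a = pair (tagged (F xy a)) (untagged (U xy a))

    collect-traces : ∀ x y a → collect (repl (λ z → trace (z ∷ y) a) x) ≡ U (x ∷ y) a
    collect-traces x y a = begin
      ⋃ (⋃ (sep (λ e → ∅ ∈ e) (⋃ (repl (λ z → trace (z ∷ y) a) x))))
        ≡⟨ cong (λ s → ⋃ (⋃ s)) (sep-tagged (λ z → tagged (F (z ∷ y) a)) (λ z → untagged (U (z ∷ y) a)) x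
                                     (λ z → ∅∈tagged _ , ∅∉untagged _)) ⟩
      ⋃ (⋃ (repl (λ z → pair ∅ (F (z ∷ y) a)) x))
        ≡⟨ ⋃⋃-repl-pair∅ (λ z → F (z ∷ y) a) x ⟩
      U (x ∷ y) a ∎
      where open ≡-Reasoning

    result-trace : ∀ xy a → result (trace xy a) ≡ U xy a
    result-trace xy a = begin
      ⋃ (⋃ (⋃ (sep (λ e → ¬ (∅ ∈ e)) (trace xy a))))
        ≡⟨ cong (λ s → ⋃ (⋃ (⋃ s))) (sep-untagged _ _ (∅∈tagged _) (∅∉untagged _)) ⟩
      ⋃ (⋃ (⋃ (sing (sing (sing (U xy a))))))
        ≡⟨ cong (λ s → ⋃ (⋃ s)) (⋃-sing _) ⟩
      ⋃ (⋃ (sing (sing (U xy a))))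
        ≡⟨ cong ⋃ (⋃-sing _) ⟩
      ⋃ (sing (U xy a))
        ≡⟨ ⋃-sing _ ⟩
      U xy a ∎
      where open ≡-Reasoning

    -- The recursion step: the last safe argument is the set of earlier traces.
    trace-step : Vec V (suc n) → Vec V (suc m) → V
    trace-step xy as = pair (tagged (F xy (init as))) (untagged (collect (last as)))

    trace-recursion : ∀ x y a → trace (x ∷ y) a ≡ trace-step (x ∷ y) (a ∷ʳ repl (λ z → trace (z ∷ y) a) x)
    trace-recursion x y a
      rewrite init-∷ʳ (repl (λ z → trace (z ∷ y) a) x) a
            | last-∷ʳ (repl (λ z → trace (z ∷ y) a) x) a
            = cong (λ c → pair (tagged (F (x ∷ y) a)) (untagged c)) (sym (collect-traces x y a))

  union-replacement : ∀ {n m} {F : Vec V (suc n) → Vec V m → V} → PCSF (suc n) m F → PCSF (suc n) m (U F)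
  union-replacement {n} {m} {F} pF = ext (PCSF-result (rec PCSF-trace-step (trace-recursion F))) (result-trace F)
    where
    PCSF-untagged : ∀ {n m} {f : Vec V n → Vec V m → V} → PCSF n m f → PCSF n m (λ x a → untagged (f x a))
    PCSF-untagged pf = PCSF-sing (PCSF-sing pf)
    PCSF-trace-step : PCSF (suc n) (suc m) (trace-step F)
    PCSF-trace-step = PCSF-pair (PCSF-weaken (PCSF-pair PCSF-null pF))
                                (PCSF-untagged (PCSF-⋃ (PCSF-⋃ (PCSF-sepHas∅ (PCSF-⋃ PCSF-lastSafe)))))
    PCSF-result : ∀ {n m} {f : Vec V n → Vec V m → V} → PCSF n m f → PCSF n m (λ x a → result (f x a))
    PCSF-result pf = PCSF-⋃ (PCSF-⋃ (PCSF-⋃ (PCSF-sepLacks∅ pf)))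

proposition3p2p9 : (M : SetModel) → let open PCSFDefs M in
    ∀ {n m} (h : Vec V (suc n) → Vec V m → V) (R : Vec V (suc n) → Vec V m → Set) →
    PCSF (suc n) m h → PCSFRel (suc n) m R →
    PCSF (suc n) m (λ xy a → ⋃ (repl (λ z → h (z ∷ tail xy) a)
                                     (sep (λ z → R (z ∷ tail xy) a) (head xy))))
    × PCSF (suc n) m (λ xy a → repl (λ z → h (z ∷ tail xy) a)
                                    (sep (λ z → R (z ∷ tail xy) a) (head xy)))
proposition3p2p9 M {n} {m} h R ph (χ , pχ , χ-char) = PCSF-⋃ pg , pg
  where
  open PCSFDefs M
  open SetFacts M
  open Closure M
  open UnionReplacement M

  F : Vec V (suc n) → Vec V m → V
  F xy a = Cond (sing (h xy a)) ∅ ∅ (χ xy a)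

  pg : PCSF (suc n) m (λ xy a → repl (λ z → h (z ∷ tail xy) a) (sep (λ z → R (z ∷ tail xy) a) (head xy)))
  pg = ext (union-replacement (PCSF-Cond (PCSF-sing ph) PCSF-null PCSF-null pχ))
           λ xy a → ⋃-repl-select _ _ (head xy) λ z → Cond-characteristic _ ∅ _ (χ-char (z ∷ tail xy) a)
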